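{- Let $\mathcal C\in\{\mathrm{ID},\mathrm{CD}\}$. The rule $(lwr)$ is height-preserving admissible in $\mathsf{LBIQ}(\mathcal C)$: if $\mathcal R,\mathcal T,\Gamma\vdash\Delta,w:\varphi$ has a proof of height $n$ in $\mathsf{LBIQ}(\mathcal C)$ and $w\twoheadrightarrow^*_{\mathcal R}u$, then $\mathcal R,\mathcal T,\Gamma\vdash\Delta,u:\varphi$ has a proof of height at most $n$ in $\mathsf{LBIQ}(\mathcal C)$.
   Context: Syntax. Terms from variables and function symbols (constants have arity $0$); $\mathrm{Ter}(X)$ = terms with variables in $X$ (contains all constants), $\mathrm{Ter}=\mathrm{Ter}(\mathrm{Var})$, $\mathrm{VT}(t)$ variables of $t$, $\mathrm{VT}(\vec t)=\bigcup_i\mathrm{VT}(t_i)$. Formulae: $\varphi::=p(\vec t)\mid\bot\mid\top\mid\varphi\wedge\varphi\mid\varphi\vee\varphi\mid\varphi\mathbin{ -\!\!<}\varphi\mid\varphi\to\varphi\mid\exists x\varphi\mid\forall x\varphi$ ($\mathbin{ -\!\!<}$ exclusion); $\varphi(t/x)$ capture-avoiding substitution. Sequents. Labeled formula $w:\varphi$, relational atom $wRu$, domain atom $w:x$. A sequent is $\mathcal R,\mathcal T,\Gamma\vdash\Delta$ ($\mathcal R$ finite multiset of relational atoms, $\mathcal T$ of domain atoms, $\Gamma,\Delta$ of labeled formulae) with (1) if $\mathcal R\ne\emptyset$ every label in $\mathcal T,\Gamma,\Delta$ occurs in $\mathcal R$, and if $\mathcal R=\emptyset$ exactly one label occurs;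 (2) the directed graph of $\mathcal R$ connected without directed or undirected cycles. $w\twoheadrightarrow^*_{\mathcal R}u$ iff $w=u$ or there is a chain $wRv_1,\dots,v_nRu$ in $\mathcal R$. $X_w=\{x\mid u:x\in\mathcal T,\ u\twoheadrightarrow^*_{\mathcal R}w\}$; $t$ available for $w$ iff $t\in\mathrm{Ter}(X_w)$. Fresh = not occurring in the conclusion; side conditions evaluated in the conclusion. $\mathsf{LBIQ}(\mathrm{ID})$ (premises$\,/\,$conclusion, unchanged parts omitted): (ax) $\Gamma,w:p(\vec t)\vdash\Delta,u:p(\vec t)$ if $w\twoheadrightarrow^*_{\mathcal R}u$; $(\bot L)$ $\Gamma,w:\bot\vdash\Delta$; $(\top R)$ $\Gamma\vdash\Delta,w:\top$; $(\wedge L)$ $\Gamma,w:\varphi,w:\psi\vdash\Delta\,/\,\Gamma,w:\varphi\wedge\psi\vdash\Delta$; $(\wedge R)$ $\Gamma\vdash\Delta,w:\varphi$ and $\Gamma\vdash\Delta,w:\psi\,/\,\Gamma\vdash\Delta,w:\varphi\wedge\psi$; $(\vee L)$ $\Gamma,w:\varphi\vdash\Delta$ and $\Gamma,w:\psi\vdash\Delta\,/\,\Gamma,w:\varphi\vee\psi\vdash\Delta$; $(\vee R)$ $\Gamma\vdash\Delta,w:\varphi,w:\psi\,/\,\Gamma\vdash\Delta,w:\varphi\vee\psi$; $(\to L)$ $\Gamma,w:\varphi\to\psi\vdash\Delta,u:\varphi$ and $\Gamma,w:\varphi\to\psi,u:\psi\vdash\Delta\,/\,\Gamma,w:\varphi\to\psi\vdash\Delta$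 if $w\twoheadrightarrow^*_{\mathcal R}u$; $(\to R)$ $\mathcal R,wRu,\mathcal T,\Gamma,u:\varphi\vdash\Delta,u:\psi\,/\,\mathcal R,\mathcal T,\Gamma\vdash\Delta,w:\varphi\to\psi$, $u$ fresh; $(\mathbin{ -\!\!<}L)$ $\mathcal R,uRw,\mathcal T,\Gamma,u:\varphi\vdash\Delta,u:\psi\,/\,\mathcal R,\mathcal T,\Gamma,w:\varphi\mathbin{ -\!\!<}\psi\vdash\Delta$, $u$ fresh; $(\mathbin{ -\!\!<}R)$ $\Gamma\vdash\Delta,u:\varphi\mathbin{ -\!\!<}\psi,w:\varphi$ and $\Gamma,w:\psi\vdash\Delta,u:\varphi\mathbin{ -\!\!<}\psi\,/\,\Gamma\vdash\Delta,u:\varphi\mathbin{ -\!\!<}\psi$ if $w\twoheadrightarrow^*_{\mathcal R}u$; $(\exists L)$ $\mathcal R,\mathcal T,w:y,\Gamma,w:\varphi(y/x)\vdash\Delta\,/\,\mathcal R,\mathcal T,\Gamma,w:\exists x\varphi\vdash\Delta$, $y$ fresh; $(\exists R)$ $\Gamma\vdash\Delta,w:\exists x\varphi,w:\varphi(t/x)\,/\,\Gamma\vdash\Delta,w:\exists x\varphi$ if $t$ available for $w$; $(\forall L)$ $\Gamma,w:\forall x\varphi,u:\varphi(t/x)\vdash\Delta\,/\,\Gamma,w:\forall x\varphi\vdash\Delta$ if $w\twoheadrightarrow^*_{\mathcal R}u$ and $t$ available for $u$; $(\forall R)$ $\mathcal R,wRu,\mathcal T,u:y,\Gamma\vdash\Delta,u:\varphi(y/x)\,/\,\mathcal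 R,\mathcal T,\Gamma\vdash\Delta,w:\forall x\varphi$, $u,y$ fresh; $(ds)$ $\mathcal R,\mathcal T,w:\mathrm{VT}(\vec t),\Gamma,w:p(\vec t)\vdash\Delta\,/\,\mathcal R,\mathcal T,\Gamma,w:p(\vec t)\vdash\Delta$. $\mathsf{LBIQ}(\mathrm{CD})$: remove $(ds)$, allow any $t\in\mathrm{Ter}$ in $(\exists R)$ and $(\forall L)$ (keeping $w\twoheadrightarrow^*_{\mathcal R}u$ in $(\forall L)$). Proofs are finite trees of rule instances with leaves (ax), $(\bot L)$, $(\top R)$; height = length of the longest branch. Sequents differing by a bijective label renaming are regarded as mutually derivable. -}

module Defs where

open import Data.Nat using (ℕ; zero; suc; _<_; _⊔_; _≟_) public
open import Data.Fin using (Fin)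
open import Data.Bool using (Bool; true; false)
open import Data.Product using (Σ; _×_; _,_; proj₁; proj₂) public
open import Data.Unit using (⊤)
open import Relation.Nullary using (yes; no)
open import Data.List using (List; []; _∷_; _++_; map; concatMap; length; lookup; deduplicate) public
open import Data.List.Membership.Propositional using (_∈_; _∉_) public
open import Data.List.Relation.Unary.All using (All) public
open import Data.List.Relation.Unary.Unique.Propositional using (Unique) public
open import Data.List.Relation.Binary.Permutation.Propositional using (_↭_) public
open import Relation.Binary.PropositionalEquality using (_≡_; _≢_) public

-- Syntax (locally nameless: bound variables are de Bruijn indices `bv`,
-- free variables are names `fv x` with x : ℕ).  A function symbol is a
-- name f : ℕ applied to a list of arguments (its arity = list length);
-- constants are function symbols applied to [].

data Term : Set where
  bv : ℕ → Term
  fv : ℕ → Term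
  fn : ℕ → List Term → Term

data Fml : Set where
  atom : ℕ → List Term → Fml
  ⊥'   : Fml
  ⊤'   : Fml
  _∧'_ : Fml → Fml → Fml
  _∨'_ : Fml → Fml → Fml
  _-<_ : Fml → Fml → Fml
  _⇒_  : Fml → Fml → Fml
  ex   : Fml → Fml             -- ∃x φ (x = bound index 0)
  all  : Fml → Fml

mutual
  openT : ℕ → Term → Term → Term
  openT k t (bv i) with i ≟ k
  ... | yes _ = t
  ... | no _ = bv i
  openT k t (fv x) = fv x
  openT k t (fn f ts) = fn f (openTs k t ts)

  openTs : ℕ → Term → List Term → List Term
  openTs k t [] = []
  openTs k t (s ∷ ss) = openT k t s ∷ openTs k t ss

openF : ℕ → Term → Fml → Fml
openF k t (atom p ts) = atom p (openTs k t ts)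
openF k t ⊥' = ⊥'
openF k t ⊤' = ⊤'
openF k t (φ ∧' ψ) = openF k t φ ∧' openF k t ψ
openF k t (φ ∨' ψ) = openF k t φ ∨' openF k t ψ
openF k t (φ -< ψ) = openF k t φ -< openF k t ψ
openF k t (φ ⇒ ψ) = openF k t φ ⇒ openF k t ψ
openF k t (ex φ) = ex (openF (suc k) t φ)
openF k t (all φ) = all (openF (suc k) t φ)

_[_] : Fml → Term → Fml
φ [ t ] = openF 0 t φ

mutual
  fvT : Term → List ℕ
  fvT (bv i) = []
  fvT (fv x) = x ∷ []
  fvT (fn f ts) = fvTs ts

  fvTs : List Term → List ℕ
  fvTs [] = []
  fvTs (t ∷ ts) = fvT t ++ fvTs ts

fvF : Fml → List ℕ
fvF (atom p ts) = fvTs ts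
fvF ⊥' = []
fvF ⊤' = []
fvF (φ ∧' ψ) = fvF φ ++ fvF ψ
fvF (φ ∨' ψ) = fvF φ ++ fvF ψ
fvF (φ -< ψ) = fvF φ ++ fvF ψ
fvF (φ ⇒ ψ) = fvF φ ++ fvF ψ
fvF (ex φ) = fvF φ
fvF (all φ) = fvF φ

VT : List Term → List ℕ
VT ts = deduplicate _≟_ (fvTs ts)

mutual
  -- all bound indices are < k  (lcT 0 t: t is a genuine term in Ter)
  lcT : ℕ → Term → Set
  lcT k (bv i) = i < k
  lcT k (fv x) = ⊤
  lcT k (fn f ts) = lcTs k ts

  lcTs : ℕ → List Term → Set
  lcTs k [] = ⊤
  lcTs k (t ∷ ts) = lcT k t × lcTs k ts

lcF : ℕ → Fml → Set
lcF k (atom p ts) = lcTs k ts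
lcF k ⊥' = ⊤
lcF k ⊤' = ⊤
lcF k (φ ∧' ψ) = lcF k φ × lcF k ψ
lcF k (φ ∨' ψ) = lcF k φ × lcF k ψ
lcF k (φ -< ψ) = lcF k φ × lcF k ψ
lcF k (φ ⇒ ψ) = lcF k φ × lcF k ψ
lcF k (ex φ) = lcF (suc k) φ
lcF k (all φ) = lcF (suc k) φ

-- Relational atom wRu  = (w , u) ∈ R ; domain atom w:x = (w , x) ∈ T ;
-- labeled formula w:φ = (w , φ).  Multisets are lists (rules act up to
-- permutation, see below).

Label = ℕ
LF = Label × Fml

record Sequent : Set where
  constructor seq
  field
    Rs : List (Label × Label)
    Ts : List (Label × ℕ)
    Γ  : List LF
    Δ  : List LF
open Sequent public

data Reach (R : List (Label × Label)) : Label → Label → Set where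
  here : ∀ {w} → Reach R w w
  step : ∀ {w v u} → (w , v) ∈ R → Reach R v u → Reach R w u

-- t available for w  (t ∈ Ter(X_w))
Available : List (Label × Label) → List (Label × ℕ) → Label → Term → Set
Available R T w t =
  lcT 0 t × All (λ x → Σ Label (λ v → ((v , x) ∈ T) × Reach R v w)) (fvT t)

data Calc : Set where
  ID CD : Calc

Inst : Calc → List (Label × Label) → List (Label × ℕ) → Label → Term → Set
Inst ID R T w t = Available R T w t
Inst CD R T w t = lcT 0 t

edgeLabels : List (Label × Label) → List Label
edgeLabels R = concatMap (λ e → proj₁ e ∷ proj₂ e ∷ []) R

otherLabels : Sequent → List Label
otherLabels s = map proj₁ (Ts s) ++ map proj₁ (Γ s) ++ map proj₁ (Δ s)

labels : Sequent → List Label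
labels s = edgeLabels (Rs s) ++ otherLabels s

vars : Sequent → List ℕ
vars s = map proj₂ (Ts s) ++ concatMap (λ a → fvF (proj₂ a)) (Γ s ++ Δ s)

FreshL : Label → Sequent → Set
FreshL u s = u ∉ labels s

FreshV : ℕ → Sequent → Set
FreshV y s = y ∉ vars s

data Walk (R : List (Label × Label)) : Label → Label → List (Fin (length R)) → Set where
  nil  : ∀ {v} → Walk R v v []
  fwd  : ∀ {a b c es} (e : Fin (length R)) → lookup R e ≡ (a , b) →
         Walk R b c es → Walk R a c (e ∷ es)
  bwd  : ∀ {a b c es} (e : Fin (length R)) → lookup R e ≡ (b , a) →
         Walk R b c es → Walk R a c (e ∷ es)

Connected : List (Label × Label) → Set
Connected R = ∀ a b → a ∈ edgeLabels R → b ∈ edgeLabels R →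
  Σ (List (Fin (length R))) (λ es → Walk R a b es)

Acyclic : List (Label × Label) → Set
Acyclic R = ∀ v es → Walk R v v es → Unique es → es ≡ []

WF : Sequent → Set
WF s =
  (Rs s ≢ [] → All (λ l → l ∈ edgeLabels (Rs s)) (otherLabels s)) ×
  (Rs s ≡ [] → Σ Label (λ w → All (λ l → l ≡ w) (otherLabels s) × w ∈ otherLabels s)) ×
  Connected (Rs s) × Acyclic (Rs s) ×
  All (λ a → lcF 0 (proj₂ a)) (Γ s ++ Δ s)

-- A principal formula that is
-- removed is located with a permutation (multiset decomposition), one that
-- is kept with membership.  Side conditions refer to the conclusion.

data Proof (C : Calc) : Sequent → Set where
  ax  : ∀ {R T Γ Δ w u p ts} → (w , atom p ts) ∈ Γ → (u , atom p ts) ∈ Δ →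
        Reach R w u → Proof C (seq R T Γ Δ)
  ⊥L  : ∀ {R T Γ Δ w} → (w , ⊥') ∈ Γ → Proof C (seq R T Γ Δ)
  ⊤R  : ∀ {R T Γ Δ w} → (w , ⊤') ∈ Δ → Proof C (seq R T Γ Δ)
  ∧L  : ∀ {R T Γ Γ' Δ w φ ψ} → Γ ↭ ((w , φ ∧' ψ) ∷ Γ') →
        Proof C (seq R T ((w , φ) ∷ (w , ψ) ∷ Γ') Δ) → Proof C (seq R T Γ Δ)
  ∧R  : ∀ {R T Γ Δ Δ' w φ ψ} → Δ ↭ ((w , φ ∧' ψ) ∷ Δ') →
        Proof C (seq R T Γ ((w , φ) ∷ Δ')) → Proof C (seq R T Γ ((w , ψ) ∷ Δ')) →
        Proof C (seq R T Γ Δ)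
  ∨L  : ∀ {R T Γ Γ' Δ w φ ψ} → Γ ↭ ((w , φ ∨' ψ) ∷ Γ') →
        Proof C (seq R T ((w , φ) ∷ Γ') Δ) → Proof C (seq R T ((w , ψ) ∷ Γ') Δ) →
        Proof C (seq R T Γ Δ)
  ∨R  : ∀ {R T Γ Δ Δ' w φ ψ} → Δ ↭ ((w , φ ∨' ψ) ∷ Δ') →
        Proof C (seq R T Γ ((w , φ) ∷ (w , ψ) ∷ Δ')) → Proof C (seq R T Γ Δ)
  ⇒L  : ∀ {R T Γ Δ w u φ ψ} → (w , φ ⇒ ψ) ∈ Γ → Reach R w u →
        Proof C (seq R T Γ ((u , φ) ∷ Δ)) → Proof C (seq R T ((u , ψ) ∷ Γ) Δ) →
        Proof C (seq R T Γ Δ)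
  ⇒R  : ∀ {R T Γ Δ Δ' w u φ ψ} → Δ ↭ ((w , φ ⇒ ψ) ∷ Δ') →
        FreshL u (seq R T Γ Δ) →
        Proof C (seq ((w , u) ∷ R) T ((u , φ) ∷ Γ) ((u , ψ) ∷ Δ')) →
        Proof C (seq R T Γ Δ)
  -<L : ∀ {R T Γ Γ' Δ w u φ ψ} → Γ ↭ ((w , φ -< ψ) ∷ Γ') →
        FreshL u (seq R T Γ Δ) →
        Proof C (seq ((u , w) ∷ R) T ((u , φ) ∷ Γ') ((u , ψ) ∷ Δ)) →
        Proof C (seq R T Γ Δ)
  -<R : ∀ {R T Γ Δ w u φ ψ} → (u , φ -< ψ) ∈ Δ → Reach R w u →
        Proof C (seq R T Γ ((w , φ) ∷ Δ)) → Proof C (seq R T ((w , ψ) ∷ Γ) Δ) →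
        Proof C (seq R T Γ Δ)
  ∃L  : ∀ {R T Γ Γ' Δ w y φ} → Γ ↭ ((w , ex φ) ∷ Γ') →
        FreshV y (seq R T Γ Δ) →
        Proof C (seq R ((w , y) ∷ T) ((w , φ [ fv y ]) ∷ Γ') Δ) →
        Proof C (seq R T Γ Δ)
  ∃R  : ∀ {R T Γ Δ w φ} (t : Term) → (w , ex φ) ∈ Δ → Inst C R T w t →
        Proof C (seq R T Γ ((w , φ [ t ]) ∷ Δ)) → Proof C (seq R T Γ Δ)
  ∀L  : ∀ {R T Γ Δ w u φ} (t : Term) → (w , all φ) ∈ Γ → Reach R w u →
        Inst C R T u t →
        Proof C (seq R T ((u , φ [ t ]) ∷ Γ) Δ) → Proof C (seq R T Γ Δ)
  ∀R  : ∀ {R T Γ Δ Δ' w u y φ} → Δ ↭ ((w , all φ) ∷ Δ') →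
        FreshL u (seq R T Γ Δ) → FreshV y (seq R T Γ Δ) →
        Proof C (seq ((w , u) ∷ R) ((u , y) ∷ T) Γ ((u , φ [ fv y ]) ∷ Δ')) →
        Proof C (seq R T Γ Δ)
  ds  : ∀ {R T Γ Δ w p ts} → C ≡ ID → (w , atom p ts) ∈ Γ →
        Proof C (seq R (map (λ x → (w , x)) (VT ts) ++ T) Γ Δ) →
        Proof C (seq R T Γ Δ)

height : ∀ {C s} → Proof C s → ℕ
height (ax _ _ _) = 0
height (⊥L _) = 0
height (⊤R _) = 0
height (∧L _ p) = suc (height p)
height (∧R _ p q) = suc (height p ⊔ height q)
height (∨L _ p q) = suc (height p ⊔ height q)
height (∨R _ p) = suc (height p)
height (⇒L _ _ p q) = suc (height p ⊔ height q)
height (⇒R _ _ p) = suc (height p)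
height (-<L _ _ p) = suc (height p)
height (-<R _ _ p q) = suc (height p ⊔ height q)
height (∃L _ _ p) = suc (height p)
height (∃R _ _ _ p) = suc (height p)
height (∀L _ _ _ _ p) = suc (height p)
height (∀R _ _ _ p) = suc (height p)
height (ds _ _ p) = suc (height p)

-- Raising a succedent formula from w to a successor u can change the relational
-- context: in (→R) and (∀R) the eigen-edge wRv of the original premise becomes
-- uRv.  So we prove a more general statement by induction on the proof: every
-- succedent label may be raised along the new relational context R', where each
-- edge of the old R is a path in R' and R' uses no new labels.  Under these
-- conditions every reachability side condition survives, and no freshness
-- condition is violated because the new sequent has no new labels or variables.
module Submission where

open import Defs
open import Data.Nat using (ℕ; _≤_; s≤s; z≤n)
open import Data.Nat.Properties using (⊔-mono-≤)
open import Data.Sum using (_⊎_; inj₁; inj₂)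
open import Data.List.Relation.Unary.Any using (here; there)
open import Data.List.Relation.Binary.Permutation.Propositional using (refl; prep; swap; trans)
import Data.List.Relation.Unary.All as All
open import Data.List.Relation.Binary.Subset.Propositional using (_⊆_)
open import Data.List.Relation.Binary.Subset.Propositional.Properties using (⊆-refl)
open import Data.List.Membership.Propositional.Properties using (∈-++⁻; ∈-++⁺ˡ; ∈-++⁺ʳ)
open import Relation.Binary.PropositionalEquality using (refl; cong; subst)

Reach-trans : ∀ {R a b c} → Reach R a b → Reach R b c → Reach R a c
Reach-trans here r = r
Reach-trans (step e r) r′ = step e (Reach-trans r r′)

Reach-weaken : ∀ {R e a b} → Reach R a b → Reach (e ∷ R) a b
Reach-weaken here = here
Reach-weaken (step e r) = step (there e) (Reach-weaken r)

target∈edgeLabels : ∀ {R a b} → (a , b) ∈ R → b ∈ edgeLabels R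
target∈edgeLabels {_ ∷ _} (here refl) = there (here refl)
target∈edgeLabels {_ ∷ _} (there e) = there (there (target∈edgeLabels e))

Reach-target : ∀ {R a b} → Reach R a b → b ≡ a ⊎ b ∈ edgeLabels R
Reach-target here = inj₁ refl
Reach-target (step e r) with Reach-target r
... | inj₁ refl = inj₂ (target∈edgeLabels e)
... | inj₂ b∈R = inj₂ b∈R

_⊑_ : List (Label × Label) → List (Label × Label) → Set
R ⊑ R′ = ∀ {a b} → (a , b) ∈ R → Reach R′ a b

⊑-refl : ∀ {R} → R ⊑ R
⊑-refl e = step e here

⊑-Reach : ∀ {R R′ a b} → R ⊑ R′ → Reach R a b → Reach R′ a b
⊑-Reach R⊑R′ here = here
⊑-Reach R⊑R′ (step e r) = Reach-trans (R⊑R′ e) (⊑-Reach R⊑R′ r)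

∷-mono-⊑ : ∀ {R R′ e} → R ⊑ R′ → (e ∷ R) ⊑ (e ∷ R′)
∷-mono-⊑ R⊑R′ (here refl) = step (here refl) here
∷-mono-⊑ R⊑R′ (there e) = Reach-weaken (R⊑R′ e)

raise-source-⊑ : ∀ {R R′ a b v} → R ⊑ R′ → Reach R′ a b → ((a , v) ∷ R) ⊑ ((b , v) ∷ R′)
raise-source-⊑ R⊑R′ r (here refl) = Reach-trans (Reach-weaken r) (step (here refl) here)
raise-source-⊑ R⊑R′ r (there e) = Reach-weaken (R⊑R′ e)

∷-mono-edgeLabels : ∀ {R R′ e} → edgeLabels R′ ⊆ edgeLabels R →
                    edgeLabels (e ∷ R′) ⊆ edgeLabels (e ∷ R)
∷-mono-edgeLabels sub (here p) = here p
∷-mono-edgeLabels sub (there (here p)) = there (here p)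
∷-mono-edgeLabels sub (there (there l)) = there (there (sub l))

raise-source-edgeLabels : ∀ {R R′ a b v} → edgeLabels R′ ⊆ edgeLabels R → Reach R′ a b →
                          edgeLabels ((b , v) ∷ R′) ⊆ edgeLabels ((a , v) ∷ R)
raise-source-edgeLabels sub r (here refl) with Reach-target r
... | inj₁ refl = here refl
... | inj₂ b∈R′ = there (there (sub b∈R′))
raise-source-edgeLabels sub r (there (here p)) = there (here p)
raise-source-edgeLabels sub r (there (there l)) = there (there (sub l))

data Raised (R : List (Label × Label)) : List LF → List LF → Set where
  []  : Raised R [] []
  _∷_ : ∀ {a b χ Δ Δ′} → Reach R a b → Raised R Δ Δ′ → Raised R ((a , χ) ∷ Δ) ((b , χ) ∷ Δ′)

Raised-weaken : ∀ {R e Δ Δ′} → Raised R Δ Δ′ → Raised (e ∷ R) Δ Δ′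
Raised-weaken [] = []
Raised-weaken (r ∷ rs) = Reach-weaken r ∷ Raised-weaken rs

Raised-refl : ∀ {R} Δ → Raised R Δ Δ
Raised-refl [] = []
Raised-refl (_ ∷ Δ) = here ∷ Raised-refl Δ

Raised-↭ : ∀ {R Δ Θ Δ′} → Δ ↭ Θ → Raised R Δ Δ′ → Σ (List LF) (λ Θ′ → Raised R Θ Θ′ × Δ′ ↭ Θ′)
Raised-↭ refl rs = _ , rs , refl
Raised-↭ (prep _ π) (r ∷ rs) with Raised-↭ π rs
... | _ , rs′ , π′ = _ , r ∷ rs′ , prep _ π′
Raised-↭ (swap _ _ π) (r ∷ r′ ∷ rs) with Raised-↭ π rs
... | _ , rs′ , π′ = _ , r′ ∷ r ∷ rs′ , swap _ _ π′
Raised-↭ (trans π ρ) rs with Raised-↭ π rs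
... | _ , rs′ , π′ with Raised-↭ ρ rs′
... | _ , rs″ , ρ′ = _ , rs″ , trans π′ ρ′

Raised-∈ : ∀ {R Δ Δ′ w χ} → (w , χ) ∈ Δ → Raised R Δ Δ′ →
           Σ Label (λ b → ((b , χ) ∈ Δ′) × Reach R w b)
Raised-∈ (here refl) (r ∷ rs) = _ , here refl , r
Raised-∈ (there m) (r ∷ rs) with Raised-∈ m rs
... | b , m′ , r′ = b , there m′ , r′

Raised-labels : ∀ {R Δ Δ′ l} → Raised R Δ Δ′ → l ∈ map proj₁ Δ′ → l ∈ map proj₁ Δ ⊎ l ∈ edgeLabels R
Raised-labels (r ∷ rs) (here refl) with Reach-target r
... | inj₁ refl = inj₁ (here refl)
... | inj₂ b∈R = inj₂ b∈R
Raised-labels (r ∷ rs) (there l) with Raised-labels rs l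
... | inj₁ l∈Δ = inj₁ (there l∈Δ)
... | inj₂ l∈R = inj₂ l∈R

Raised-formulas : ∀ {R} Γ {Δ Δ′} → Raised R Δ Δ′ →
                  concatMap (λ a → fvF (proj₂ a)) (Γ ++ Δ′) ≡ concatMap (λ a → fvF (proj₂ a)) (Γ ++ Δ)
Raised-formulas [] [] = refl
Raised-formulas [] (_∷_ {χ = χ} r rs) = cong (fvF χ ++_) (Raised-formulas [] rs)
Raised-formulas (a ∷ Γ) rs = cong (fvF (proj₂ a) ++_) (Raised-formulas Γ rs)

labels-raise : ∀ {R R′ T Γ Δ Δ′} → edgeLabels R′ ⊆ edgeLabels R → Raised R′ Δ Δ′ →
               labels (seq R′ T Γ Δ′) ⊆ labels (seq R T Γ Δ)
labels-raise {R} {R′} {T} {Γ} sub rs l with ∈-++⁻ (edgeLabels R′) l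
... | inj₁ l∈R′ = ∈-++⁺ˡ (sub l∈R′)
... | inj₂ l with ∈-++⁻ (map proj₁ T) l
... | inj₁ l∈T = ∈-++⁺ʳ (edgeLabels R) (∈-++⁺ˡ l∈T)
... | inj₂ l with ∈-++⁻ (map proj₁ Γ) l
... | inj₁ l∈Γ = ∈-++⁺ʳ (edgeLabels R) (∈-++⁺ʳ (map proj₁ T) (∈-++⁺ˡ l∈Γ))
... | inj₂ l with Raised-labels rs l
... | inj₁ l∈Δ = ∈-++⁺ʳ (edgeLabels R) (∈-++⁺ʳ (map proj₁ T) (∈-++⁺ʳ (map proj₁ Γ) l∈Δ))
... | inj₂ l∈R′ = ∈-++⁺ˡ (sub l∈R′)

FreshL-raise : ∀ {R R′ T Γ Δ Δ′ u} → edgeLabels R′ ⊆ edgeLabels R → Raised R′ Δ Δ′ →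
               FreshL u (seq R T Γ Δ) → FreshL u (seq R′ T Γ Δ′)
FreshL-raise {R} {R′} {T} {Γ} sub rs fresh l = fresh (labels-raise {R} {R′} {T} {Γ} sub rs l)

FreshV-raise : ∀ {R R′ T Γ Δ Δ′ y} → Raised R′ Δ Δ′ →
               FreshV y (seq R T Γ Δ) → FreshV y (seq R′ T Γ Δ′)
FreshV-raise {T = T} {Γ} rs fresh y∈ =
  fresh (subst (_ ∈_) (cong (map proj₂ T ++_) (Raised-formulas Γ rs)) y∈)

Inst-raise : ∀ {C R R′ T w b t} → R ⊑ R′ → Reach R′ w b → Inst C R T w t → Inst C R′ T b t
Inst-raise {ID} R⊑R′ r (lc , avail) =
  lc , All.map (λ { (v , v∶x , v↠w) → v , v∶x , Reach-trans (⊑-Reach R⊑R′ v↠w) r }) avail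
Inst-raise {CD} R⊑R′ r lc = lc

raise : ∀ {C R T Γ Δ} (p : Proof C (seq R T Γ Δ)) → ∀ {R′ Δ′} →
        R ⊑ R′ → edgeLabels R′ ⊆ edgeLabels R → Raised R′ Δ Δ′ →
        Σ (Proof C (seq R′ T Γ Δ′)) (λ q → height q ≤ height p)
raise (ax mΓ mΔ r) R⊑R′ sub rs with Raised-∈ mΔ rs
... | _ , mΔ′ , r′ = ax mΓ mΔ′ (Reach-trans (⊑-Reach R⊑R′ r) r′) , z≤n
raise (⊥L m) R⊑R′ sub rs = ⊥L m , z≤n
raise (⊤R m) R⊑R′ sub rs with Raised-∈ m rs
... | _ , m′ , _ = ⊤R m′ , z≤n
raise (∧L π p) R⊑R′ sub rs =
  let q , h = raise p R⊑R′ sub rs in ∧L π q , s≤s h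
raise (∧R π p p′) R⊑R′ sub rs with Raised-↭ π rs
... | _ , r ∷ rs′ , π′ =
  let q , h = raise p R⊑R′ sub (r ∷ rs′) ; q′ , h′ = raise p′ R⊑R′ sub (r ∷ rs′)
  in ∧R π′ q q′ , s≤s (⊔-mono-≤ h h′)
raise (∨L π p p′) R⊑R′ sub rs =
  let q , h = raise p R⊑R′ sub rs ; q′ , h′ = raise p′ R⊑R′ sub rs
  in ∨L π q q′ , s≤s (⊔-mono-≤ h h′)
raise (∨R π p) R⊑R′ sub rs with Raised-↭ π rs
... | _ , r ∷ rs′ , π′ =
  let q , h = raise p R⊑R′ sub (r ∷ r ∷ rs′) in ∨R π′ q , s≤s h
raise (⇒L m r p p′) R⊑R′ sub rs =
  let q , h = raise p R⊑R′ sub (here ∷ rs) ; q′ , h′ = raise p′ R⊑R′ sub rs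
  in ⇒L m (⊑-Reach R⊑R′ r) q q′ , s≤s (⊔-mono-≤ h h′)
raise {R = R} {T} {Γ} (⇒R π fresh p) {R′} R⊑R′ sub rs with Raised-↭ π rs
... | _ , r ∷ rs′ , π′ =
  let q , h = raise p (raise-source-⊑ R⊑R′ r) (raise-source-edgeLabels {R} {R′} sub r)
                      (here ∷ Raised-weaken rs′)
  in ⇒R π′ (FreshL-raise {R} {R′} {T} {Γ} sub rs fresh) q , s≤s h
raise {R = R} {T} {Γ} (-<L π fresh p) {R′} R⊑R′ sub rs =
  let q , h = raise p (∷-mono-⊑ R⊑R′) (∷-mono-edgeLabels {R} {R′} sub) (here ∷ Raised-weaken rs)
  in -<L π (FreshL-raise {R} {R′} {T} {Γ} sub rs fresh) q , s≤s h
raise (-<R m r p p′) R⊑R′ sub rs with Raised-∈ m rs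
... | _ , m′ , r′ =
  let q , h = raise p R⊑R′ sub (here ∷ rs) ; q′ , h′ = raise p′ R⊑R′ sub rs
  in -<R m′ (Reach-trans (⊑-Reach R⊑R′ r) r′) q q′ , s≤s (⊔-mono-≤ h h′)
raise {R = R} {T} {Γ} (∃L π fresh p) {R′} R⊑R′ sub rs =
  let q , h = raise p R⊑R′ sub rs in ∃L π (FreshV-raise {R} {R′} {T} {Γ} rs fresh) q , s≤s h
raise {C = C} {T = T} (∃R t m i p) R⊑R′ sub rs with Raised-∈ m rs
... | _ , m′ , r′ =
  let q , h = raise p R⊑R′ sub (r′ ∷ rs) in ∃R t m′ (Inst-raise {C} {T = T} {t = t} R⊑R′ r′ i) q , s≤s h
raise {C = C} {T = T} (∀L t m r i p) R⊑R′ sub rs =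
  let q , h = raise p R⊑R′ sub rs
  in ∀L t m (⊑-Reach R⊑R′ r) (Inst-raise {C} {T = T} {t = t} R⊑R′ here i) q , s≤s h
raise {R = R} {T} {Γ} (∀R π freshL freshV p) {R′} R⊑R′ sub rs with Raised-↭ π rs
... | _ , r ∷ rs′ , π′ =
  let q , h = raise p (raise-source-⊑ R⊑R′ r) (raise-source-edgeLabels {R} {R′} sub r)
                      (here ∷ Raised-weaken rs′)
  in ∀R π′ (FreshL-raise {R} {R′} {T} {Γ} sub rs freshL) (FreshV-raise {R} {R′} {T} {Γ} rs freshV) q
       , s≤s h
raise (ds e m p) R⊑R′ sub rs =
  let q , h = raise p R⊑R′ sub rs in ds e m q , s≤s h

lemma37 : (C : Calc) (R : List (Label × Label)) (T : List (Label × ℕ))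
          (Γ Δ : List LF) (w u : Label) (φ : Fml) (n : ℕ) →
          WF (seq R T Γ ((w , φ) ∷ Δ)) →
          (p : Proof C (seq R T Γ ((w , φ) ∷ Δ))) → height p ≡ n →
          Reach R w u →
          Σ (Proof C (seq R T Γ ((u , φ) ∷ Δ))) (λ q → height q ≤ n)
lemma37 C R T Γ Δ w u φ n _ p refl w↠u = raise p ⊑-refl ⊆-refl (w↠u ∷ Raised-refl Δ)
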